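{- Let $X$ be a finite set and let $\tau$ be a subset of $\binom{X}{2}$ with $L(\tau)=X$. The following are equivalent: (i) $\tau$ is thin; (ii) there exists a rooted binary phylogenetic $X$-tree $T$ for which the function $s\mapsto{\rm lca}_T(s)$ from $\tau$ to the set of interior vertices of $T$ is one-to-one; (iii) there exists a rooted caterpillar tree $T$ on $X$ for which the function $s\mapsto{\rm lca}_T(s)$ from $\tau$ to the set of interior vertices of $T$ is one-to-one.
   Context: $L(\tau)=\bigcup_{s\in\tau}s$; $\tau\subseteq\binom{X}{2}$ is thin if $|L(\tau')|\ge|\tau'|+1$ for every non-empty $\tau'\subseteq\tau$. A rooted binary phylogenetic $X$-tree is a rooted tree with labelled leaf set $X$ (leaves = out-degree 0 vertices) whose non-leaf vertices are unlabelled with out-degree exactly 2; interior vertices are the non-leaf vertices (including the root). A cherry is a pair of leaves adjacent to a common vertex; a rooted caterpillar tree on $X$ is a rooted binary phylogenetic $X$-tree with at most one cherry. For $s\subseteq X$, ${\rm lca}_T(s)$ is the least common ancestor in $T$ of the elements of $s$. -}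

module Defs where

open import Data.Nat using (ℕ; zero; suc; _+_; _≤_)
open import Data.Fin using (Fin)
open import Data.Fin.Subset using (Subset; _∪_; ⊥; ⊤; ∣_∣) renaming (_∈_ to _∈ₛ_)
open import Data.List using (List; []; _∷_; _++_; length; foldr)
open import Data.List.Membership.Propositional using (_∈_)
open import Data.List.Relation.Unary.Unique.Propositional using (Unique)
open import Data.List.Relation.Binary.Sublist.Propositional using (_⊆_)
open import Data.Product using (_×_; Σ; ∃)
open import Relation.Binary.PropositionalEquality using (_≡_; _≢_)

-- The finite set X is Fin n.  A subset of X is a 'Subset n'.
-- τ ⊆ (X choose 2) is a duplicate-free list of subsets of X, each of size 2.

L : ∀ {n} → List (Subset n) → Subset n
L = foldr _∪_ ⊥

TwoSubsets : ∀ {n} → List (Subset n) → Set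
TwoSubsets {n} τ = ∀ {s : Subset n} → s ∈ τ → ∣ s ∣ ≡ 2

-- τ is thin: |L(τ')| ≥ |τ'| + 1 for every non-empty τ' ⊆ τ.
-- (τ is duplicate-free, so subsets of τ are exactly its sublists.)
Thin : ∀ {n} → List (Subset n) → Set
Thin {n} τ = ∀ (τ' : List (Subset n)) → τ' ⊆ τ → τ' ≢ [] → length τ' + 1 ≤ ∣ L τ' ∣

data Tree (n : ℕ) : Set where
  leaf : Fin n → Tree n
  node : Tree n → Tree n → Tree n

leaves : ∀ {n} → Tree n → List (Fin n)
leaves (leaf x)   = x ∷ []
leaves (node l r) = leaves l ++ leaves r

IsPhylogenetic : ∀ {n} → Tree n → Set
IsPhylogenetic {n} t = Unique (leaves t) × (∀ (x : Fin n) → x ∈ leaves t)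

-- vertices of a tree, given as paths from the root
data Pos {n : ℕ} : Tree n → Set where
  root : ∀ {t} → Pos t
  goL  : ∀ {l r} → Pos l → Pos (node l r)
  goR  : ∀ {l r} → Pos r → Pos (node l r)

data Interior {n : ℕ} : {t : Tree n} → Pos t → Set where
  rootI : ∀ {l r} → Interior {t = node l r} root
  goLI  : ∀ {l r} {p : Pos l} → Interior p → Interior {t = node l r} (goL p)
  goRI  : ∀ {l r} {p : Pos r} → Interior p → Interior {t = node l r} (goR p)

subtree : ∀ {n} (t : Tree n) → Pos t → Tree n
subtree t          root    = t
subtree (node l r) (goL p) = subtree l p
subtree (node l r) (goR p) = subtree r p

data _≼_ {n : ℕ} : {t : Tree n} → Pos t → Pos t → Set where
  root≼ : ∀ {t} {q : Pos t} → root ≼ q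
  goL≼  : ∀ {l r} {p q : Pos l} → p ≼ q → _≼_ {t = node l r} (goL p) (goL q)
  goR≼  : ∀ {l r} {p q : Pos r} → p ≼ q → _≼_ {t = node l r} (goR p) (goR q)

CommonAncestor : ∀ {n} (t : Tree n) → Subset n → Pos t → Set
CommonAncestor {n} t s p = ∀ (x : Fin n) → x ∈ₛ s → x ∈ leaves (subtree t p)

IsLca : ∀ {n} (t : Tree n) → Subset n → Pos t → Set
IsLca t s p = CommonAncestor t s p × (∀ q → CommonAncestor t s q → q ≼ p)

LcaInjective : ∀ {n} (t : Tree n) → List (Subset n) → Set
LcaInjective {n} t τ =
  (∀ {s : Subset n} → s ∈ τ → Σ (Pos t) λ p → IsLca t s p × Interior p) ×
  (∀ {s s' : Subset n} → s ∈ τ → s' ∈ τ → (p : Pos t) → IsLca t s p → IsLca t s' p → s ≡ s')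

cherries : ∀ {n} → Tree n → ℕ
cherries (leaf _)   = 0
cherries (node l r) = cherryHere l r + cherries l + cherries r
  where
  cherryHere : Tree _ → Tree _ → ℕ
  cherryHere (leaf _) (leaf _) = 1
  cherryHere _ _ = 0

-- rooted caterpillar tree: at most one cherry
IsCaterpillar : ∀ {n} → Tree n → Set
IsCaterpillar t = IsPhylogenetic t × cherries t ≤ 1

-- Send every member of a subfamily τ′ ⊆ τ to its lca; this is an interior vertex at which
-- the member meets both subtrees, and distinct members go to distinct vertices. By induction on the
-- tree, such a placement satisfies |τ′| + 1 ≤ |L(τ′) ∪ {x}| for every leaf x: the members placed in
-- the two subtrees cover disjoint sets of leaves, and at most one member is placed at the root, where
-- it reaches into both subtrees. Taking x ∈ L(τ′) gives thinness.
--
-- Counting incidences, |L(σ)| + |{vertices in two members of σ}| ≤ 2|σ|, so a thin σ has a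
-- vertex v lying in at most one member. Hang v below the root, next to a caterpillar built recursively
-- for the other vertices and the members avoiding v: the member containing v gets the root as its lca,
-- and every other member keeps its lca.

module Submission where

open import Defs
open import Data.Nat using (ℕ; suc; _+_; _≤_; _<_; z≤n; s≤s)
open import Data.Nat.ListAction using (sum)
open import Data.Nat.Properties
  using (+-suc; +-comm; +-assoc; +-identityʳ; +-mono-≤; +-monoʳ-≤; +-mono-<; +-cancelˡ-<;
         m≤m+n; ≤-refl; ≤-reflexive; ≤-trans; ≤-pred; 1+n≰n; <⇒≱; module ≤-Reasoning)
open import Data.Bool using (true; false)
open import Data.Vec using ([]; _∷_)
open import Data.Fin using (Fin; zero; _≟_)
open import Data.Fin.Properties using (¬∀⟶∃¬)
open import Data.Fin.Subset using (Subset; _∪_; _∩_; ⊥; ⊤; ∣_∣; ⁅_⁆; Nonempty; Empty)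
  renaming (_∈_ to _∈ₛ_; _∉_ to _∉ₛ_; _⊆_ to _⊆ₛ_)
open import Data.Fin.Subset.Properties
  using (_∈?_; nonempty?; Empty-unique; ∣⊥∣≡0; ∣⁅x⁆∣≡1; x∈⁅x⁆; x∈⁅y⁆⇒x≡y; ∉⊥;
         x∈p∪q⁺; x∈p∪q⁻; x∈p∩q⁺; x∈p∩q⁻; p⊆p∪q; q⊆p∪q; ∣p∣≤∣p∪q∣; ∣q∣≤∣p∪q∣; p⊆q⇒∣p∣≤∣q∣)
open import Data.List using (List; []; _∷_; _++_; length; map; filter; allFin)
open import Data.List.Properties using (length-map; filter-notAll)
open import Data.List.Membership.Propositional using (_∈_; _∉_; mapWith∈; find; lose)
open import Data.List.Membership.Propositional.Properties
  using (∈-++⁺ˡ; ∈-++⁺ʳ; ∈-++⁻; ∈-map⁻; ∈-filter⁺; ∈-filter⁻; ∈-allFin; map-mapWith∈; mapWith∈-id)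
open import Data.List.Relation.Unary.Any as Any using (Any; here; there)
open import Data.List.Relation.Unary.All as All using (All; []; _∷_)

import Data.List.Relation.Unary.All.Properties as Allₚ

open import Data.List.Relation.Unary.AllPairs using (AllPairs; []; _∷_)
open import Data.List.Relation.Unary.Unique.Propositional using (Unique)
open import Data.List.Relation.Binary.Sublist.Propositional using (_⊆_; []; _∷_; _∷ʳ_; ⊆-refl; ⊆-trans)
open import Data.List.Relation.Binary.Sublist.Propositional.Properties
  using (All-resp-⊆; Any-resp-⊆; filter-⊆)
open import Data.Product using (_×_; Σ; ∃; _,_; proj₁; proj₂; uncurry; map₁; map₂)
open import Data.Sum using (inj₁; inj₂; [_,_]′)
open import Data.Empty using (⊥-elim)
open import Function using (id; _∘_; _on_)
open import Function.Bundles using (_⇔_; mk⇔)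
open import Relation.Nullary using (¬_; Dec; yes; no; contradiction)
open import Relation.Nullary.Decidable using (¬?; _→-dec_; decidable-stable)
open import Relation.Binary.PropositionalEquality
  using (_≡_; _≢_; refl; sym; trans; cong; cong₂; subst; module ≡-Reasoning)

∣p∪q∣+∣p∩q∣≡∣p∣+∣q∣ : ∀ {n} (p q : Subset n) → ∣ p ∪ q ∣ + ∣ p ∩ q ∣ ≡ ∣ p ∣ + ∣ q ∣
∣p∪q∣+∣p∩q∣≡∣p∣+∣q∣ []          []          = refl
∣p∪q∣+∣p∩q∣≡∣p∣+∣q∣ (true ∷ p)  (true ∷ q)  =
  cong suc (trans (+-suc _ _) (trans (cong suc (∣p∪q∣+∣p∩q∣≡∣p∣+∣q∣ p q)) (sym (+-suc _ _))))
∣p∪q∣+∣p∩q∣≡∣p∣+∣q∣ (true ∷ p)  (false ∷ q) = cong suc (∣p∪q∣+∣p∩q∣≡∣p∣+∣q∣ p q)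
∣p∪q∣+∣p∩q∣≡∣p∣+∣q∣ (false ∷ p) (true ∷ q)  =
  trans (cong suc (∣p∪q∣+∣p∩q∣≡∣p∣+∣q∣ p q)) (sym (+-suc _ _))
∣p∪q∣+∣p∩q∣≡∣p∣+∣q∣ (false ∷ p) (false ∷ q) = ∣p∪q∣+∣p∩q∣≡∣p∣+∣q∣ p q

∣p∪q∣≤∣p∣+∣q∣ : ∀ {n} (p q : Subset n) → ∣ p ∪ q ∣ ≤ ∣ p ∣ + ∣ q ∣
∣p∪q∣≤∣p∣+∣q∣ p q = subst (∣ p ∪ q ∣ ≤_) (∣p∪q∣+∣p∩q∣≡∣p∣+∣q∣ p q) (m≤m+n _ _)

Empty[p∩q]⇒∣p∪q∣≡∣p∣+∣q∣ : ∀ {n} (p q : Subset n) → Empty (p ∩ q) → ∣ p ∪ q ∣ ≡ ∣ p ∣ + ∣ q ∣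
Empty[p∩q]⇒∣p∪q∣≡∣p∣+∣q∣ {n} p q empty = begin
  ∣ p ∪ q ∣             ≡⟨ sym (+-identityʳ _) ⟩
  ∣ p ∪ q ∣ + 0         ≡⟨ cong (∣ p ∪ q ∣ +_) (sym (∣⊥∣≡0 n)) ⟩
  ∣ p ∪ q ∣ + ∣ ⊥ {n} ∣ ≡⟨ cong (λ r → ∣ p ∪ q ∣ + ∣ r ∣) (sym (Empty-unique empty)) ⟩
  ∣ p ∪ q ∣ + ∣ p ∩ q ∣ ≡⟨ ∣p∪q∣+∣p∩q∣≡∣p∣+∣q∣ p q ⟩
  ∣ p ∣ + ∣ q ∣         ∎
  where open ≡-Reasoning

∣p∪⁅x⁆∣≤1+∣p∣ : ∀ {n} (p : Subset n) x → ∣ p ∪ ⁅ x ⁆ ∣ ≤ suc ∣ p ∣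
∣p∪⁅x⁆∣≤1+∣p∣ p x =
  subst (∣ p ∪ ⁅ x ⁆ ∣ ≤_) (trans (cong (∣ p ∣ +_) (∣⁅x⁆∣≡1 x)) (+-comm ∣ p ∣ 1)) (∣p∪q∣≤∣p∣+∣q∣ p ⁅ x ⁆)

_⊆ₗ_ : ∀ {n} → Subset n → List (Fin n) → Set
p ⊆ₗ xs = ∀ {x} → x ∈ₛ p → x ∈ xs

disjoint⇒∣p∪q∣≡∣p∣+∣q∣ : ∀ {n} {xs ys : List (Fin n)} {p q : Subset n} →
                        (∀ {x} → x ∈ xs → x ∉ ys) → p ⊆ₗ xs → q ⊆ₗ ys → ∣ p ∪ q ∣ ≡ ∣ p ∣ + ∣ q ∣
disjoint⇒∣p∪q∣≡∣p∣+∣q∣ {p = p} {q} xs#ys p⊆xs q⊆ys = Empty[p∩q]⇒∣p∪q∣≡∣p∣+∣q∣ p q λ (y , y∈p∩q) →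
  let (y∈p , y∈q) = x∈p∩q⁻ p q y∈p∩q in xs#ys (p⊆xs y∈p) (q⊆ys y∈q)

∪-lub : ∀ {n} {p q : Subset n} {P : Fin n → Set} →
        (∀ {x} → x ∈ₛ p → P x) → (∀ {x} → x ∈ₛ q → P x) → ∀ {x} → x ∈ₛ p ∪ q → P x
∪-lub {p = p} {q} f g x∈p∪q = [ f , g ]′ (x∈p∪q⁻ p q x∈p∪q)

⁅⁆-elim : ∀ {n} {x : Fin n} {P : Fin n → Set} → P x → ∀ {y} → y ∈ₛ ⁅ x ⁆ → P y
⁅⁆-elim {x = x} {P} px y∈⁅x⁆ = subst P (sym (x∈⁅y⁆⇒x≡y x y∈⁅x⁆)) px

∣p∣≡1+k⇒Nonempty : ∀ {n k} {p : Subset n} → ∣ p ∣ ≡ suc k → Nonempty p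
∣p∣≡1+k⇒Nonempty {n} {p = p} ∣p∣≡1+k with nonempty? p
... | yes nonempty = nonempty
... | no empty with trans (sym ∣p∣≡1+k) (trans (cong ∣_∣ (Empty-unique empty)) (∣⊥∣≡0 n))
...   | ()

⊈⇒∃∉ : ∀ {n} {p q : Subset n} → ¬ p ⊆ₛ q → ∃ λ x → x ∈ₛ p × x ∉ₛ q
⊈⇒∃∉ {n} {p} {q} p⊈q with ¬∀⟶∃¬ n (λ x → x ∈ₛ p → x ∈ₛ q) (λ x → x ∈? p →-dec x ∈? q) (λ p⊆q → p⊈q (p⊆q _))
... | x , x∈p↛x∈q =
  x , decidable-stable (x ∈? p) (λ x∉p → x∈p↛x∈q (⊥-elim ∘ x∉p)) , (λ x∈q → x∈p↛x∈q (λ _ → x∈q))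

Unique-++⁻ : ∀ {A : Set} (xs : List A) {ys} → Unique (xs ++ ys) →
             Unique xs × Unique ys × (∀ {x} → x ∈ xs → x ∉ ys)
Unique-++⁻ []       unique        = [] , unique , λ ()
Unique-++⁻ (x ∷ xs) (x∉ ∷ unique) with Unique-++⁻ xs unique
... | uxs , uys , xs#ys = Allₚ.++⁻ˡ xs x∉ ∷ uxs , uys , λ where
  (here refl)  y∈ys → All.lookup (Allₚ.++⁻ʳ xs x∉) y∈ys refl
  (there x∈xs) y∈ys → xs#ys x∈xs y∈ys

AllPairs-resp-⊆ : ∀ {A : Set} {R : A → A → Set} {xs ys : List A} → xs ⊆ ys → AllPairs R ys → AllPairs R xs
AllPairs-resp-⊆ []            []         = []
AllPairs-resp-⊆ (_ ∷ʳ xs⊆ys)  (_ ∷ rys)  = AllPairs-resp-⊆ xs⊆ys rys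
AllPairs-resp-⊆ (refl ∷ xs⊆ys) (ry ∷ rys) = All-resp-⊆ xs⊆ys ry ∷ AllPairs-resp-⊆ xs⊆ys rys

All-mapWith∈ : ∀ {A B : Set} {P : B → Set} (xs : List A) {f : ∀ {x} → x ∈ xs → B} →
               (∀ {x} (x∈xs : x ∈ xs) → P (f x∈xs)) → All P (mapWith∈ xs f)
All-mapWith∈ []       _ = []
All-mapWith∈ (x ∷ xs) p = p (here refl) ∷ All-mapWith∈ xs (p ∘ there)

AllPairs-mapWith∈ : ∀ {A B : Set} {S : A → A → Set} {R : B → B → Set} {xs : List A} {f : ∀ {x} → x ∈ xs → B} →
                    (∀ {x y} (x∈xs : x ∈ xs) (y∈xs : y ∈ xs) → S x y → R (f x∈xs) (f y∈xs)) →
                    AllPairs S xs → AllPairs R (mapWith∈ xs f)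
AllPairs-mapWith∈ _ [] = []
AllPairs-mapWith∈ {xs = _ ∷ xs} h (sx ∷ sxs) =
  All-mapWith∈ xs (λ y∈xs → h (here refl) (there y∈xs) (All.lookup sx y∈xs)) ∷
  AllPairs-mapWith∈ (λ x∈xs y∈xs → h (there x∈xs) (there y∈xs)) sxs

∈L⁺ : ∀ {n} {σ : List (Subset n)} {s x} → s ∈ σ → x ∈ₛ s → x ∈ₛ L σ
∈L⁺ (here refl)  x∈s = x∈p∪q⁺ (inj₁ x∈s)
∈L⁺ (there s∈σ) x∈s = x∈p∪q⁺ (inj₂ (∈L⁺ s∈σ x∈s))

∈L⁻ : ∀ {n} (σ : List (Subset n)) {x} → x ∈ₛ L σ → ∃ λ s → s ∈ σ × x ∈ₛ s
∈L⁻ []      x∈L = ⊥-elim (∉⊥ x∈L)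
∈L⁻ (s ∷ σ) x∈L with x∈p∪q⁻ s (L σ) x∈L
... | inj₁ x∈s  = s , here refl , x∈s
... | inj₂ x∈Lσ = map₂ (map₁ there) (∈L⁻ σ x∈Lσ)

L-mono : ∀ {n} {σ σ′ : List (Subset n)} → σ ⊆ σ′ → L σ ⊆ₛ L σ′
L-mono {σ = σ} σ⊆σ′ x∈L with ∈L⁻ σ x∈L
... | s , s∈σ , x∈s = ∈L⁺ (Any-resp-⊆ σ⊆σ′ s∈σ) x∈s

Thin-resp-⊆ : ∀ {n} {σ σ′ : List (Subset n)} → σ′ ⊆ σ → Thin σ → Thin σ′
Thin-resp-⊆ σ′⊆σ thin τ τ⊆σ′ = thin τ (⊆-trans τ⊆σ′ σ′⊆σ)

shared : ∀ {n} → List (Subset n) → Subset n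
shared []      = ⊥
shared (s ∷ σ) = (s ∩ L σ) ∪ shared σ

∉shared⇒≡ : ∀ {n} {σ : List (Subset n)} {v s s′} → v ∉ₛ shared σ →
            s ∈ σ → s′ ∈ σ → v ∈ₛ s → v ∈ₛ s′ → s ≡ s′
∉shared⇒≡ v∉ (here refl) (here refl)   _   _    = refl
∉shared⇒≡ v∉ (here refl) (there s′∈σ) v∈s v∈s′ = ⊥-elim (v∉ (x∈p∪q⁺ (inj₁ (x∈p∩q⁺ (v∈s , ∈L⁺ s′∈σ v∈s′)))))
∉shared⇒≡ v∉ (there s∈σ) (here refl)  v∈s v∈s′ = ⊥-elim (v∉ (x∈p∪q⁺ (inj₁ (x∈p∩q⁺ (v∈s′ , ∈L⁺ s∈σ v∈s)))))
∉shared⇒≡ v∉ (there s∈σ) (there s′∈σ) v∈s v∈s′ = ∉shared⇒≡ (v∉ ∘ x∈p∪q⁺ ∘ inj₂) s∈σ s′∈σ v∈s v∈s′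

-- Double counting: a vertex of L σ contributes at least 1 to the sum, a shared one at least 2.
∣L∣+∣shared∣≤∑∣s∣ : ∀ {n} (σ : List (Subset n)) → ∣ L σ ∣ + ∣ shared σ ∣ ≤ sum (map ∣_∣ σ)
∣L∣+∣shared∣≤∑∣s∣ {n} []      = ≤-reflexive (cong₂ _+_ (∣⊥∣≡0 n) (∣⊥∣≡0 n))
∣L∣+∣shared∣≤∑∣s∣     (s ∷ σ) = begin
  ∣ s ∪ L σ ∣ + ∣ (s ∩ L σ) ∪ shared σ ∣       ≤⟨ +-monoʳ-≤ ∣ s ∪ L σ ∣ (∣p∪q∣≤∣p∣+∣q∣ (s ∩ L σ) (shared σ)) ⟩
  ∣ s ∪ L σ ∣ + (∣ s ∩ L σ ∣ + ∣ shared σ ∣)   ≡⟨ sym (+-assoc ∣ s ∪ L σ ∣ _ _) ⟩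
  ∣ s ∪ L σ ∣ + ∣ s ∩ L σ ∣ + ∣ shared σ ∣     ≡⟨ cong (_+ ∣ shared σ ∣) (∣p∪q∣+∣p∩q∣≡∣p∣+∣q∣ s (L σ)) ⟩
  ∣ s ∣ + ∣ L σ ∣ + ∣ shared σ ∣               ≡⟨ +-assoc ∣ s ∣ _ _ ⟩
  ∣ s ∣ + (∣ L σ ∣ + ∣ shared σ ∣)             ≤⟨ +-monoʳ-≤ ∣ s ∣ (∣L∣+∣shared∣≤∑∣s∣ σ) ⟩
  ∣ s ∣ + sum (map ∣_∣ σ)                      ∎
  where open ≤-Reasoning

∑∣s∣≡2∣σ∣ : ∀ {n} {σ : List (Subset n)} → TwoSubsets σ → sum (map ∣_∣ σ) ≡ length σ + length σ
∑∣s∣≡2∣σ∣ {σ = []}    _   = refl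
∑∣s∣≡2∣σ∣ {σ = s ∷ σ} two =
  trans (cong₂ _+_ (two (here refl)) (∑∣s∣≡2∣σ∣ (two ∘ there))) (cong suc (sym (+-suc (length σ) (length σ))))

thin⇒unshared : ∀ {n} {σ : List (Subset n)} → TwoSubsets σ → Thin σ → σ ≢ [] →
                ∃ λ v → v ∈ₛ L σ × v ∉ₛ shared σ
thin⇒unshared {σ = σ} two thin σ≢[] = ⊈⇒∃∉ (λ L⊆shared → <⇒≱ ∣shared∣<∣L∣ (p⊆q⇒∣p∣≤∣q∣ L⊆shared))
  where
  ∣σ∣<∣L∣ : length σ < ∣ L σ ∣
  ∣σ∣<∣L∣ = subst (_≤ ∣ L σ ∣) (+-comm (length σ) 1) (thin σ ⊆-refl σ≢[])
  ∣shared∣<∣L∣ : ∣ shared σ ∣ < ∣ L σ ∣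
  ∣shared∣<∣L∣ = +-cancelˡ-< ∣ L σ ∣ _ _ (begin-strict
    ∣ L σ ∣ + ∣ shared σ ∣   ≤⟨ ∣L∣+∣shared∣≤∑∣s∣ σ ⟩
    sum (map ∣_∣ σ)         ≡⟨ ∑∣s∣≡2∣σ∣ two ⟩
    length σ + length σ     <⟨ +-mono-< ∣σ∣<∣L∣ ∣σ∣<∣L∣ ⟩
    ∣ L σ ∣ + ∣ L σ ∣        ∎)
    where open ≤-Reasoning

some-leaf : ∀ {n} (t : Tree n) → ∃ λ x → x ∈ leaves t
some-leaf (leaf x)   = x , here refl
some-leaf (node l r) = map₂ ∈-++⁺ˡ (some-leaf l)

leaves-subtree : ∀ {n} (t : Tree n) (p : Pos t) {x} → x ∈ leaves (subtree t p) → x ∈ leaves t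
leaves-subtree t          root    x∈ = x∈
leaves-subtree (node l r) (goL p) x∈ = ∈-++⁺ˡ (leaves-subtree l p x∈)
leaves-subtree (node l r) (goR p) x∈ = ∈-++⁺ʳ (leaves l) (leaves-subtree r p x∈)

IsLca-goL⁻ : ∀ {n} {l r : Tree n} {s p} → IsLca (node l r) s (goL p) → IsLca l s p
IsLca-goL⁻ (ca , least) = ca , λ q ca′ → case (least (goL q) ca′)
  where
  case : ∀ {q p} → _≼_ {t = node _ _} (goL q) (goL p) → q ≼ p
  case (goL≼ q≼p) = q≼p

IsLca-goR⁻ : ∀ {n} {l r : Tree n} {s p} → IsLca (node l r) s (goR p) → IsLca r s p
IsLca-goR⁻ (ca , least) = ca , λ q ca′ → case (least (goR q) ca′)
  where
  case : ∀ {q p} → _≼_ {t = node _ _} (goR q) (goR p) → q ≼ p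
  case (goR≼ q≼p) = q≼p

¬CommonAncestor-leaf : ∀ {n} {x : Fin n} {s} → ∣ s ∣ ≡ 2 → ¬ CommonAncestor (leaf x) s root
¬CommonAncestor-leaf {x = x} {s} ∣s∣≡2 ca = 1+n≰n (begin
  2             ≡⟨ sym ∣s∣≡2 ⟩
  ∣ s ∣         ≤⟨ p⊆q⇒∣p∣≤∣q∣ s⊆⁅x⁆ ⟩
  ∣ ⁅ x ⁆ ∣     ≡⟨ ∣⁅x⁆∣≡1 x ⟩
  1             ∎)
  where
  open ≤-Reasoning
  s⊆⁅x⁆ : s ⊆ₛ ⁅ x ⁆
  s⊆⁅x⁆ {y} y∈s with ca y y∈s
  ... | here refl = x∈⁅x⁆ x

-- Thin families have lca-injective caterpillars

_∉?_ : ∀ {n} (v : Fin n) (s : Subset n) → Dec (v ∉ₛ s)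
v ∉? s = ¬? (v ∈? s)

avoiding : ∀ {n} → Fin n → List (Subset n) → List (Subset n)
avoiding v = filter (v ∉?_)

avoiding-⊆ : ∀ {n} (v : Fin n) σ → avoiding v σ ⊆ σ
avoiding-⊆ v = filter-⊆ (v ∉?_)

∈L-avoiding⁻ : ∀ {n} {v x : Fin n} σ → x ∈ₛ L (avoiding v σ) → x ∈ₛ L σ × x ≢ v
∈L-avoiding⁻ {v = v} σ x∈L with ∈L⁻ (avoiding v σ) x∈L
... | s , s∈σ′ , x∈s with ∈-filter⁻ (v ∉?_) {xs = σ} s∈σ′
... | s∈σ , v∉s = ∈L⁺ s∈σ x∈s , λ { refl → v∉s x∈s }

module _ {n} {v : Fin n} {t : Tree n} {s : Subset n} (∣s∣≡2 : ∣ s ∣ ≡ 2) where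

  IsLca-attach-root : v ∉ leaves t → v ∈ₛ s → s ⊆ₗ (v ∷ leaves t) → IsLca (node (leaf v) t) s root
  IsLca-attach-root v∉t v∈s s⊆ = (λ _ → s⊆) , least
    where
    least : ∀ q → CommonAncestor (node (leaf v) t) s q → q ≼ root
    least root       _  = root≼
    least (goL root) ca = ⊥-elim (¬CommonAncestor-leaf ∣s∣≡2 ca)
    least (goR q)    ca = ⊥-elim (v∉t (leaves-subtree t q (ca v v∈s)))

  IsLca-attach-goR : ∀ {p} → IsLca t s p → IsLca (node (leaf v) t) s (goR p)
  IsLca-attach-goR (ca , least) = ca , least⁺
    where
    least⁺ : ∀ q → CommonAncestor (node (leaf v) t) s q → q ≼ goR _
    least⁺ root       _  = root≼
    least⁺ (goL root) ca = ⊥-elim (¬CommonAncestor-leaf ∣s∣≡2 ca)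
    least⁺ (goR q)    ca = goR≼ (least q ca)

IsLca-attach-root⁻ : ∀ {n} {v : Fin n} {t s} → IsLca (node (leaf v) t) s root → v ∈ₛ s
IsLca-attach-root⁻ {v = v} {t} {s} (ca , least) = decidable-stable (v ∈? s) below
  where
  s⊆t : v ∉ₛ s → CommonAncestor (node (leaf v) t) s (goR root)
  s⊆t v∉s x x∈s with ca x x∈s
  ... | here refl = ⊥-elim (v∉s x∈s)
  ... | there x∈t = x∈t
  below : ¬ v ∉ₛ s
  below v∉s with least (goR root) (s⊆t v∉s)
  ... | ()

IsLca-attach-goR⁻ : ∀ {n} {v : Fin n} {t s p} → v ∉ leaves t → IsLca (node (leaf v) t) s (goR p) → v ∉ₛ s
IsLca-attach-goR⁻ {v = v} {t} {p = p} v∉t (ca , _) v∈s = v∉t (leaves-subtree t p (ca v v∈s))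

attach-lcaInjective : ∀ {n} {v : Fin n} {t : Tree n} {σ} → v ∉ leaves t → TwoSubsets σ →
                      L σ ⊆ₗ (v ∷ leaves t) → v ∉ₛ shared σ → LcaInjective t (avoiding v σ) →
                      LcaInjective (node (leaf v) t) σ
attach-lcaInjective {v = v} {t} {σ} v∉t two σ⊆ v∉shared (lca , inj) = lca⁺ , inj⁺
  where
  lca⁺ : ∀ {s} → s ∈ σ → Σ (Pos (node (leaf v) t)) λ p → IsLca (node (leaf v) t) s p × Interior p
  lca⁺ {s} s∈σ with v ∈? s
  ... | yes v∈s = root , IsLca-attach-root (two s∈σ) v∉t v∈s (σ⊆ ∘ ∈L⁺ s∈σ) , rootI
  ... | no  v∉s with lca (∈-filter⁺ (v ∉?_) s∈σ v∉s)
  ...   | p , isLca , interior = goR p , IsLca-attach-goR (two s∈σ) isLca , goRI interior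
  inj⁺ : ∀ {s s′} → s ∈ σ → s′ ∈ σ → ∀ p → IsLca _ s p → IsLca _ s′ p → s ≡ s′
  inj⁺ s∈σ s′∈σ root isLca isLca′ =
    ∉shared⇒≡ v∉shared s∈σ s′∈σ (IsLca-attach-root⁻ isLca) (IsLca-attach-root⁻ isLca′)
  inj⁺ s∈σ _ (goL root) (ca , _) _ = ⊥-elim (¬CommonAncestor-leaf (two s∈σ) ca)
  inj⁺ s∈σ s′∈σ (goR p) isLca isLca′ =
    inj (avoids s∈σ isLca) (avoids s′∈σ isLca′) p (IsLca-goR⁻ isLca) (IsLca-goR⁻ isLca′)
    where
    avoids : ∀ {s} → s ∈ σ → IsLca (node (leaf v) t) s (goR p) → s ∈ avoiding v σ
    avoids s∈σ isLca = ∈-filter⁺ (v ∉?_) s∈σ (IsLca-attach-goR⁻ v∉t isLca)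

caterpillar : ∀ {n} → Fin n → List (Fin n) → Tree n
caterpillar x []       = leaf x
caterpillar v (x ∷ xs) = node (leaf v) (caterpillar x xs)

leaves-caterpillar : ∀ {n} (x : Fin n) xs → leaves (caterpillar x xs) ≡ x ∷ xs
leaves-caterpillar x []       = refl
leaves-caterpillar v (x ∷ xs) = cong (v ∷_) (leaves-caterpillar x xs)

cherries-caterpillar : ∀ {n} (x : Fin n) xs → cherries (caterpillar x xs) ≤ 1
cherries-caterpillar x []           = z≤n
cherries-caterpillar v (x ∷ [])     = ≤-refl
cherries-caterpillar v (x ∷ y ∷ xs) = cherries-caterpillar x (y ∷ xs)

data PeelingOrder {n} : List (Fin n) → List (Subset n) → Set where
  []  : ∀ {σ} → PeelingOrder [] σ
  _∷_ : ∀ {v vs σ} → v ∉ₛ shared σ → PeelingOrder vs (avoiding v σ) → PeelingOrder (v ∷ vs) σ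

leaf-lcaInjective : ∀ {n} {x : Fin n} {σ} → TwoSubsets σ → L σ ⊆ₗ (x ∷ []) → LcaInjective (leaf x) σ
leaf-lcaInjective {σ = σ} two σ⊆ = (λ s∈σ → ⊥-elim (absent s∈σ)) , (λ s∈σ _ _ _ _ → ⊥-elim (absent s∈σ))
  where
  absent : ∀ {s} → s ∉ σ
  absent s∈σ = ¬CommonAncestor-leaf (two s∈σ) (λ _ → σ⊆ ∘ ∈L⁺ s∈σ)

caterpillar-lcaInjective : ∀ {n} (x : Fin n) xs {σ} → Unique (x ∷ xs) → TwoSubsets σ → L σ ⊆ₗ (x ∷ xs) →
                           PeelingOrder (x ∷ xs) σ → LcaInjective (caterpillar x xs) σ
caterpillar-lcaInjective x []       _           two σ⊆ _ = leaf-lcaInjective two σ⊆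
caterpillar-lcaInjective v (x ∷ xs) {σ} (v∉ ∷ u) two σ⊆ (v∉shared ∷ order) =
  attach-lcaInjective v∉t two (subst (λ ys → L σ ⊆ₗ (v ∷ ys)) (sym leaves≡) σ⊆) v∉shared
    (caterpillar-lcaInjective x xs u (two ∘ Any-resp-⊆ (avoiding-⊆ v σ)) σ′⊆ order)
  where
  leaves≡ : leaves (caterpillar x xs) ≡ x ∷ xs
  leaves≡ = leaves-caterpillar x xs
  v∉t : v ∉ leaves (caterpillar x xs)
  v∉t v∈t = All.lookup v∉ (subst (v ∈_) leaves≡ v∈t) refl
  σ′⊆ : L (avoiding v σ) ⊆ₗ (x ∷ xs)
  σ′⊆ y∈L with ∈L-avoiding⁻ σ y∈L
  ... | y∈Lσ , y≢v with σ⊆ y∈Lσ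
  ...   | here y≡v = ⊥-elim (y≢v y≡v)
  ...   | there y∈xs = y∈xs

record Peeling {n} (R : List (Fin n)) (σ : List (Subset n)) : Set where
  constructor peeling
  field
    order    : List (Fin n)
    unique   : Unique order
    complete : ∀ {x} → x ∈ R → x ∈ order
    sound    : ∀ {x} → x ∈ order → x ∈ R
    peels    : PeelingOrder order σ

_≢?_ : ∀ {n} (x v : Fin n) → Dec (x ≢ v)
x ≢? v = ¬? (x ≟ v)

without : ∀ {n} → Fin n → List (Fin n) → List (Fin n)
without v = filter (_≢? v)

length-without : ∀ {n} {v : Fin n} {R} → v ∈ R → length (without v R) < length R
length-without {v = v} {R} v∈R = filter-notAll (_≢? v) R (Any.map (λ { refl x≢v → x≢v refl }) v∈R)

peeling-∷ : ∀ {n} {v : Fin n} {R σ} → v ∈ R → v ∉ₛ shared σ →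
            Peeling (without v R) (avoiding v σ) → Peeling R σ
peeling-∷ {v = v} {R} v∈R v∉shared (peeling vs unique complete sound order) =
  peeling (v ∷ vs) (All.tabulate v≢ ∷ unique) complete′ sound′ (v∉shared ∷ order)
  where
  v≢ : ∀ {x} → x ∈ vs → v ≢ x
  v≢ x∈vs refl = proj₂ (∈-filter⁻ (_≢? v) {xs = R} (sound x∈vs)) refl
  complete′ : ∀ {x} → x ∈ R → x ∈ v ∷ vs
  complete′ {x} x∈R with x ≟ v
  ... | yes refl = here refl
  ... | no x≢v   = there (complete (∈-filter⁺ (_≢? v) x∈R x≢v))
  sound′ : ∀ {x} → x ∈ v ∷ vs → x ∈ R
  sound′ (here refl)  = v∈R
  sound′ (there x∈vs) = proj₁ (∈-filter⁻ (_≢? v) {xs = R} (sound x∈vs))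

unshared-vertex : ∀ {n} {R : List (Fin n)} {σ r} → TwoSubsets σ → Thin σ → L σ ⊆ₗ R → r ∈ R →
                  ∃ λ v → v ∈ R × v ∉ₛ shared σ
unshared-vertex {σ = []}    {r} _   _    _   r∈R = r , r∈R , ∉⊥
unshared-vertex {σ = _ ∷ _}     two thin σ⊆R _   = map₂ (map₁ σ⊆R) (thin⇒unshared two thin (λ ()))

peelingOrder : ∀ {n} k (R : List (Fin n)) {σ} → length R ≤ k → TwoSubsets σ → Thin σ → L σ ⊆ₗ R →
               Peeling R σ
peelingOrder _       []        _   _   _    _ = peeling [] [] (λ ()) (λ ()) []
peelingOrder (suc k) R@(_ ∷ _) {σ} ∣R∣≤ two thin σ⊆R with unshared-vertex two thin σ⊆R (here refl)
... | v , v∈R , v∉shared =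
  peeling-∷ v∈R v∉shared (peelingOrder k (without v R) (≤-pred (≤-trans (length-without v∈R) ∣R∣≤))
    (two ∘ Any-resp-⊆ (avoiding-⊆ v σ)) (Thin-resp-⊆ (avoiding-⊆ v σ) thin) σ′⊆)
  where
  σ′⊆ : L (avoiding v σ) ⊆ₗ without v R
  σ′⊆ x∈L with ∈L-avoiding⁻ σ x∈L
  ... | x∈Lσ , x≢v = ∈-filter⁺ (_≢? v) (σ⊆R x∈Lσ) x≢v

thin⇒caterpillar : ∀ {n} → 1 ≤ n → {τ : List (Subset n)} → TwoSubsets τ → Thin τ →
                   Σ (Tree n) λ t → IsCaterpillar t × LcaInjective t τ
thin⇒caterpillar {suc m} _ two thin
  with peelingOrder _ (allFin (suc m)) ≤-refl two thin (λ {x} _ → ∈-allFin x)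
... | peeling []       _      complete _ _     = contradiction (complete (∈-allFin zero)) λ ()
... | peeling (x ∷ xs) unique complete _ order =
  caterpillar x xs ,
  ((subst Unique (sym leaves≡) unique , λ y → subst (y ∈_) (sym leaves≡) (complete (∈-allFin y))) ,
   cherries-caterpillar x xs) ,
  caterpillar-lcaInjective x xs unique two (λ {y} _ → complete (∈-allFin y)) order
  where
  leaves≡ : leaves (caterpillar x xs) ≡ x ∷ xs
  leaves≡ = leaves-caterpillar x xs

-- Lca-injective families are thin

Meets : ∀ {n} → Subset n → List (Fin n) → Set
Meets s xs = Any (_∈ₛ s) xs

¬Meets⇒⊆ʳ : ∀ {n} {s : Subset n} xs {ys} → ¬ Meets s xs → s ⊆ₗ (xs ++ ys) → s ⊆ₗ ys
¬Meets⇒⊆ʳ xs ¬meets s⊆ x∈s with ∈-++⁻ xs (s⊆ x∈s)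
... | inj₁ x∈xs = ⊥-elim (¬meets (lose x∈xs x∈s))
... | inj₂ x∈ys = x∈ys

¬Meets⇒⊆ˡ : ∀ {n} {s : Subset n} xs {ys} → ¬ Meets s ys → s ⊆ₗ (xs ++ ys) → s ⊆ₗ xs
¬Meets⇒⊆ˡ xs ¬meets s⊆ x∈s with ∈-++⁻ xs (s⊆ x∈s)
... | inj₁ x∈xs = x∈xs
... | inj₂ x∈ys = ⊥-elim (¬meets (lose x∈ys x∈s))

data Splits {n} : (t : Tree n) → Subset n → Pos t → Set where
  atRoot  : ∀ {l r s} → s ⊆ₗ leaves (node l r) → Meets s (leaves l) → Meets s (leaves r) →
            Splits (node l r) s root
  inLeft  : ∀ {l r s p} → Splits l s p → Splits (node l r) s (goL p)
  inRight : ∀ {l r s p} → Splits r s p → Splits (node l r) s (goR p)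

Splits⇒⊆ : ∀ {n} {t : Tree n} {s p} → Splits t s p → s ⊆ₗ leaves t
Splits⇒⊆ (atRoot s⊆ _ _)         = s⊆
Splits⇒⊆ (inLeft split)          = ∈-++⁺ˡ ∘ Splits⇒⊆ split
Splits⇒⊆ (inRight {l = l} split) = ∈-++⁺ʳ (leaves l) ∘ Splits⇒⊆ split

IsLca⇒Splits : ∀ {n} (t : Tree n) {s p} → IsLca t s p → Interior p → Splits t s p
IsLca⇒Splits (node l r) {s} (ca , least) rootI =
  atRoot (ca _) (decidable-stable (Any.any? (_∈? s) (leaves l)) ¬¬meetsˡ)
                (decidable-stable (Any.any? (_∈? s) (leaves r)) ¬¬meetsʳ)
  where
  -- Otherwise a child of the root would be a lower common ancestor.
  ¬¬meetsˡ : ¬ ¬ Meets s (leaves l)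
  ¬¬meetsˡ ¬meets with least (goR root) (λ _ → ¬Meets⇒⊆ʳ (leaves l) ¬meets (ca _))
  ... | ()
  ¬¬meetsʳ : ¬ ¬ Meets s (leaves r)
  ¬¬meetsʳ ¬meets with least (goL root) (λ _ → ¬Meets⇒⊆ˡ (leaves l) ¬meets (ca _))
  ... | ()
IsLca⇒Splits (node l r) isLca (goLI interior) = inLeft  (IsLca⇒Splits l (IsLca-goL⁻ isLca) interior)
IsLca⇒Splits (node l r) isLca (goRI interior) = inRight (IsLca⇒Splits r (IsLca-goR⁻ isLca) interior)

Placement : ∀ {n} (t : Tree n) → List (Subset n × Pos t) → Set
Placement t ps = All (uncurry (Splits t)) ps × AllPairs (_≢_ on proj₂) ps

L-placement⊆leaves : ∀ {n} {t : Tree n} {ps} → Placement t ps → L (map proj₁ ps) ⊆ₗ leaves t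
L-placement⊆leaves {ps = ps} (splits , _) x∈L with ∈L⁻ (map proj₁ ps) x∈L
... | _ , s∈ , x∈s with ∈-map⁻ proj₁ s∈
...   | _ , sp∈ps , refl = Splits⇒⊆ (All.lookup splits sp∈ps) x∈s

module _ {n} {l r : Tree n} where

  rootPart : List (Subset n × Pos (node l r)) → List (Subset n)
  rootPart []                 = []
  rootPart ((s , root) ∷ ps)  = s ∷ rootPart ps
  rootPart ((_ , goL _) ∷ ps) = rootPart ps
  rootPart ((_ , goR _) ∷ ps) = rootPart ps

  leftPart : List (Subset n × Pos (node l r)) → List (Subset n × Pos l)
  leftPart []                 = []
  leftPart ((_ , root) ∷ ps)  = leftPart ps
  leftPart ((s , goL p) ∷ ps) = (s , p) ∷ leftPart ps
  leftPart ((_ , goR _) ∷ ps) = leftPart ps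

  rightPart : List (Subset n × Pos (node l r)) → List (Subset n × Pos r)
  rightPart []                 = []
  rightPart ((_ , root) ∷ ps)  = rightPart ps
  rightPart ((_ , goL _) ∷ ps) = rightPart ps
  rightPart ((s , goR p) ∷ ps) = (s , p) ∷ rightPart ps

  length-parts : ∀ ps → length ps ≡ length (rootPart ps) + (length (leftPart ps) + length (rightPart ps))
  length-parts []                 = refl
  length-parts ((_ , root) ∷ ps)  = cong suc (length-parts ps)
  length-parts ((_ , goL _) ∷ ps) = trans (cong suc (length-parts ps)) (sym (+-suc _ _))
  length-parts ((_ , goR _) ∷ ps) =
    trans (cong suc (length-parts ps)) (sym (trans (cong (length (rootPart ps) +_) (+-suc _ _)) (+-suc _ _)))

  rootPart-⊆ : ∀ ps → rootPart ps ⊆ map proj₁ ps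
  rootPart-⊆ []                 = []
  rootPart-⊆ ((_ , root) ∷ ps)  = refl ∷ rootPart-⊆ ps
  rootPart-⊆ ((s , goL _) ∷ ps) = s ∷ʳ rootPart-⊆ ps
  rootPart-⊆ ((s , goR _) ∷ ps) = s ∷ʳ rootPart-⊆ ps

  leftPart-⊆ : ∀ ps → map proj₁ (leftPart ps) ⊆ map proj₁ ps
  leftPart-⊆ []                 = []
  leftPart-⊆ ((s , root) ∷ ps)  = s ∷ʳ leftPart-⊆ ps
  leftPart-⊆ ((_ , goL _) ∷ ps) = refl ∷ leftPart-⊆ ps
  leftPart-⊆ ((s , goR _) ∷ ps) = s ∷ʳ leftPart-⊆ ps

  rightPart-⊆ : ∀ ps → map proj₁ (rightPart ps) ⊆ map proj₁ ps
  rightPart-⊆ []                 = []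
  rightPart-⊆ ((s , root) ∷ ps)  = s ∷ʳ rightPart-⊆ ps
  rightPart-⊆ ((s , goL _) ∷ ps) = s ∷ʳ rightPart-⊆ ps
  rightPart-⊆ ((_ , goR _) ∷ ps) = refl ∷ rightPart-⊆ ps

  All-rootPart : ∀ {P : Subset n × Pos (node l r) → Set} {Q : Subset n → Set} →
                 (∀ {s} → P (s , root) → Q s) → ∀ {ps} → All P ps → All Q (rootPart ps)
  All-rootPart f {[]}                 []        = []
  All-rootPart f {(_ , root) ∷ _}  (px ∷ pxs) = f px ∷ All-rootPart f pxs
  All-rootPart f {(_ , goL _) ∷ _} (_  ∷ pxs) = All-rootPart f pxs
  All-rootPart f {(_ , goR _) ∷ _} (_  ∷ pxs) = All-rootPart f pxs

  All-leftPart : ∀ {P : Subset n × Pos (node l r) → Set} {Q : Subset n × Pos l → Set} →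
                 (∀ {s p} → P (s , goL p) → Q (s , p)) → ∀ {ps} → All P ps → All Q (leftPart ps)
  All-leftPart f {[]}                 []        = []
  All-leftPart f {(_ , root) ∷ _}  (_  ∷ pxs) = All-leftPart f pxs
  All-leftPart f {(_ , goL _) ∷ _} (px ∷ pxs) = f px ∷ All-leftPart f pxs
  All-leftPart f {(_ , goR _) ∷ _} (_  ∷ pxs) = All-leftPart f pxs

  All-rightPart : ∀ {P : Subset n × Pos (node l r) → Set} {Q : Subset n × Pos r → Set} →
                  (∀ {s p} → P (s , goR p) → Q (s , p)) → ∀ {ps} → All P ps → All Q (rightPart ps)
  All-rightPart f {[]}                 []        = []
  All-rightPart f {(_ , root) ∷ _}  (_  ∷ pxs) = All-rightPart f pxs
  All-rightPart f {(_ , goL _) ∷ _} (_  ∷ pxs) = All-rightPart f pxs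
  All-rightPart f {(_ , goR _) ∷ _} (px ∷ pxs) = f px ∷ All-rightPart f pxs

  leftPart-placement : ∀ {ps} → Placement (node l r) ps → Placement l (leftPart ps)
  leftPart-placement (splits , distinct) =
    All-leftPart (λ { (inLeft split) → split }) splits , pairs distinct
    where
    pairs : ∀ {ps} → AllPairs (_≢_ on proj₂) ps → AllPairs (_≢_ on proj₂) (leftPart ps)
    pairs {[]}                 []       = []
    pairs {(_ , root) ∷ _}  (_ ∷ ds) = pairs ds
    pairs {(_ , goL _) ∷ _} (d ∷ ds) = All-leftPart (λ p≢p′ p≡p′ → p≢p′ (cong goL p≡p′)) d ∷ pairs ds
    pairs {(_ , goR _) ∷ _} (_ ∷ ds) = pairs ds

  rightPart-placement : ∀ {ps} → Placement (node l r) ps → Placement r (rightPart ps)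
  rightPart-placement (splits , distinct) =
    All-rightPart (λ { (inRight split) → split }) splits , pairs distinct
    where
    pairs : ∀ {ps} → AllPairs (_≢_ on proj₂) ps → AllPairs (_≢_ on proj₂) (rightPart ps)
    pairs {[]}                 []       = []
    pairs {(_ , root) ∷ _}  (_ ∷ ds) = pairs ds
    pairs {(_ , goL _) ∷ _} (_ ∷ ds) = pairs ds
    pairs {(_ , goR _) ∷ _} (d ∷ ds) = All-rightPart (λ p≢p′ p≡p′ → p≢p′ (cong goR p≡p′)) d ∷ pairs ds

  length-rootPart≤1 : ∀ {ps} → AllPairs (_≢_ on proj₂) ps → length (rootPart ps) ≤ 1
  length-rootPart≤1 {[]}                 []             = z≤n
  length-rootPart≤1 {(_ , root) ∷ _}  (root≢ ∷ _) = s≤s (≤-reflexive (cong length (noRoot root≢)))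
    where
    noRoot : ∀ {ps} → All (λ sp → root ≢ proj₂ sp) ps → rootPart ps ≡ []
    noRoot {[]}                 []             = refl
    noRoot {(_ , root) ∷ _}  (root≢ ∷ _)   = ⊥-elim (root≢ refl)
    noRoot {(_ , goL _) ∷ _} (_ ∷ root≢s)  = noRoot root≢s
    noRoot {(_ , goR _) ∷ _} (_ ∷ root≢s)  = noRoot root≢s
  length-rootPart≤1 {(_ , goL _) ∷ _} (_ ∷ ds) = length-rootPart≤1 ds
  length-rootPart≤1 {(_ , goR _) ∷ _} (_ ∷ ds) = length-rootPart≤1 ds

-- The counting step at a node whose subtrees have leaves xs and ys: A and B are the unions of the
-- members placed in the two subtrees, U the union of all members placed in the tree.
module NodeCount {n} {xs ys : List (Fin n)} (xs#ys : ∀ {x} → x ∈ xs → x ∉ ys)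
  (x₀ : ∃ λ x → x ∈ xs) (y₀ : ∃ λ y → y ∈ ys) {a b : ℕ} {A B U : Subset n}
  (A⊆xs : A ⊆ₗ xs) (B⊆ys : B ⊆ₗ ys) (A⊆U : A ⊆ₛ U) (B⊆U : B ⊆ₛ U)
  (boundA : ∀ {x} → x ∈ xs → suc a ≤ ∣ A ∪ ⁅ x ⁆ ∣) (boundB : ∀ {y} → y ∈ ys → suc b ≤ ∣ B ∪ ⁅ y ⁆ ∣)
  where

  private
    sides : ∀ {P Q W} → P ⊆ₗ xs → Q ⊆ₗ ys → P ∪ Q ⊆ₛ W → ∣ P ∣ + ∣ Q ∣ ≤ ∣ W ∣
    sides P⊆xs Q⊆ys P∪Q⊆W = subst (_≤ _) (disjoint⇒∣p∪q∣≡∣p∣+∣q∣ xs#ys P⊆xs Q⊆ys) (p⊆q⇒∣p∣≤∣q∣ P∪Q⊆W)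

    a≤∣A∣ : a ≤ ∣ A ∣
    a≤∣A∣ = ≤-pred (≤-trans (boundA (proj₂ x₀)) (∣p∪⁅x⁆∣≤1+∣p∣ A _))

    b≤∣B∣ : b ≤ ∣ B ∣
    b≤∣B∣ = ≤-pred (≤-trans (boundB (proj₂ y₀)) (∣p∪⁅x⁆∣≤1+∣p∣ B _))

  with-root-member : ∀ {c} → Meets c xs → Meets c ys → c ⊆ₛ U → suc (suc (a + b)) ≤ ∣ U ∣
  with-root-member meetsA meetsB c⊆U with find meetsA | find meetsB
  ... | x , x∈xs , x∈c | y , y∈ys , y∈c =
    subst (_≤ ∣ U ∣) (cong suc (+-suc a b)) (≤-trans (+-mono-≤ (boundA x∈xs) (boundB y∈ys))
      (sides (∪-lub A⊆xs (⁅⁆-elim x∈xs)) (∪-lub B⊆ys (⁅⁆-elim y∈ys))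
             (∪-lub (∪-lub A⊆U (⁅⁆-elim (c⊆U x∈c))) (∪-lub B⊆U (⁅⁆-elim (c⊆U y∈c))))))

  without-root-member : ∀ {x} → x ∈ xs ++ ys → suc (a + b) ≤ ∣ U ∪ ⁅ x ⁆ ∣
  without-root-member {x} x∈ with ∈-++⁻ xs x∈
  ... | inj₁ x∈xs = ≤-trans (+-mono-≤ (boundA x∈xs) b≤∣B∣)
    (sides (∪-lub A⊆xs (⁅⁆-elim x∈xs)) B⊆ys
           (∪-lub (∪-lub (p⊆p∪q ⁅ x ⁆ ∘ A⊆U) (q⊆p∪q U ⁅ x ⁆)) (p⊆p∪q ⁅ x ⁆ ∘ B⊆U)))
  ... | inj₂ x∈ys = subst (_≤ ∣ U ∪ ⁅ x ⁆ ∣) (+-suc a b) (≤-trans (+-mono-≤ a≤∣A∣ (boundB x∈ys))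
    (sides A⊆xs (∪-lub B⊆ys (⁅⁆-elim x∈ys))
           (∪-lub (p⊆p∪q ⁅ x ⁆ ∘ A⊆U) (∪-lub (p⊆p∪q ⁅ x ⁆ ∘ B⊆U) (q⊆p∪q U ⁅ x ⁆)))))

placement-bound : ∀ {n} (t : Tree n) → Unique (leaves t) → (ps : List (Subset n × Pos t)) → Placement t ps →
                  ∀ {x} → x ∈ leaves t → suc (length ps) ≤ ∣ L (map proj₁ ps) ∪ ⁅ x ⁆ ∣
placement-bound (leaf _)   _      []               _            {x} _ =
  subst (_≤ ∣ ⊥ ∪ ⁅ x ⁆ ∣) (∣⁅x⁆∣≡1 x) (∣q∣≤∣p∪q∣ ⊥ ⁅ x ⁆)
placement-bound (leaf _)   _      ((_ , root) ∷ _) (() ∷ _ , _) _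
placement-bound (node l r) unique ps               placed       {x} x∈t =
  subst (λ m → suc m ≤ ∣ U ∪ ⁅ x ⁆ ∣) (sym (length-parts ps))
    (bound (rootPart ps) (rootPart-⊆ ps) (length-rootPart≤1 (proj₂ placed)) (All-rootPart id (proj₁ placed)))
  where
  U : Subset _
  U = L (map proj₁ ps)
  unique-l-r : Unique (leaves l) × Unique (leaves r) × (∀ {y} → y ∈ leaves l → y ∉ leaves r)
  unique-l-r = Unique-++⁻ (leaves l) unique
  open NodeCount (proj₂ (proj₂ unique-l-r)) (some-leaf l) (some-leaf r)
    (L-placement⊆leaves (leftPart-placement placed)) (L-placement⊆leaves (rightPart-placement placed))
    (L-mono (leftPart-⊆ ps)) (L-mono (rightPart-⊆ ps))
    (placement-bound l (proj₁ unique-l-r) (leftPart ps) (leftPart-placement placed))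
    (placement-bound r (proj₁ (proj₂ unique-l-r)) (rightPart ps) (rightPart-placement placed))
  bound : ∀ cs → cs ⊆ map proj₁ ps → length cs ≤ 1 → All (λ c → Splits (node l r) c root) cs →
          suc (length cs + (length (leftPart ps) + length (rightPart ps))) ≤ ∣ U ∪ ⁅ x ⁆ ∣
  bound []          _  _        _                             = without-root-member x∈t
  bound (c ∷ [])    c⊆ _        (atRoot _ meetsˡ meetsʳ ∷ []) =
    ≤-trans (with-root-member meetsˡ meetsʳ (∈L⁺ (Any-resp-⊆ c⊆ (here refl)))) (∣p∣≤∣p∪q∣ U ⁅ x ⁆)
  bound (_ ∷ _ ∷ _) _  (s≤s ()) _

lcaPlacement : ∀ {n} {t : Tree n} {τ σ} → LcaInjective t τ → σ ⊆ τ → List (Subset n × Pos t)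
lcaPlacement {σ = σ} (lca , _) σ⊆τ = mapWith∈ σ λ {s} s∈σ → s , proj₁ (lca (Any-resp-⊆ σ⊆τ s∈σ))

map-proj₁-lcaPlacement : ∀ {n} {t : Tree n} {τ σ} (li : LcaInjective t τ) (σ⊆τ : σ ⊆ τ) →
                         map proj₁ (lcaPlacement li σ⊆τ) ≡ σ
map-proj₁-lcaPlacement {σ = σ} _ _ = trans (map-mapWith∈ σ _ proj₁) (mapWith∈-id σ)

lcaPlacement-placement : ∀ {n} {t : Tree n} {τ σ} (li : LcaInjective t τ) (σ⊆τ : σ ⊆ τ) → Unique τ →
                         Placement t (lcaPlacement li σ⊆τ)
lcaPlacement-placement {t = t} {σ = σ} (lca , inj) σ⊆τ uτ =
  All-mapWith∈ σ (λ s∈σ → IsLca⇒Splits t (isLca s∈σ) (proj₂ (proj₂ (lca (τ∈ s∈σ))))) ,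
  AllPairs-mapWith∈ distinct (AllPairs-resp-⊆ σ⊆τ uτ)
  where
  τ∈ : ∀ {s} → s ∈ σ → s ∈ _
  τ∈ = Any-resp-⊆ σ⊆τ
  isLca : ∀ {s} (s∈σ : s ∈ σ) → IsLca t s (proj₁ (lca (τ∈ s∈σ)))
  isLca s∈σ = proj₁ (proj₂ (lca (τ∈ s∈σ)))
  distinct : ∀ {s s′} (s∈σ : s ∈ σ) (s′∈σ : s′ ∈ σ) → s ≢ s′ → proj₁ (lca (τ∈ s∈σ)) ≢ proj₁ (lca (τ∈ s′∈σ))
  distinct s∈σ s′∈σ s≢s′ p≡p′ =
    s≢s′ (inj (τ∈ s∈σ) (τ∈ s′∈σ) _ (isLca s∈σ) (subst (IsLca t _) (sym p≡p′) (isLca s′∈σ)))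

lcaInjective⇒thin : ∀ {n} {τ : List (Subset n)} {t : Tree n} → Unique τ → TwoSubsets τ → IsPhylogenetic t →
                    LcaInjective t τ → Thin τ
lcaInjective⇒thin _ _ _ _ [] _ []≢[] = ⊥-elim ([]≢[] refl)
lcaInjective⇒thin {t = t} uτ two (uₜ , covers) li σ@(s ∷ _) σ⊆τ _ = begin
  length σ + 1                 ≡⟨ +-comm (length σ) 1 ⟩
  suc (length σ)               ≡⟨ cong suc (trans (sym (cong length σ≡)) (length-map proj₁ ps)) ⟩
  suc (length ps)              ≤⟨ placement-bound t uₜ ps (lcaPlacement-placement li σ⊆τ uτ) (covers x) ⟩
  ∣ L (map proj₁ ps) ∪ ⁅ x ⁆ ∣ ≡⟨ cong (λ σ → ∣ L σ ∪ ⁅ x ⁆ ∣) σ≡ ⟩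
  ∣ L σ ∪ ⁅ x ⁆ ∣              ≤⟨ p⊆q⇒∣p∣≤∣q∣ x-absorbed ⟩
  ∣ L σ ∣                      ∎
  where
  open ≤-Reasoning
  ps : List (Subset _ × Pos t)
  ps = lcaPlacement li σ⊆τ
  σ≡ : map proj₁ ps ≡ σ
  σ≡ = map-proj₁-lcaPlacement li σ⊆τ
  s-nonempty : Nonempty s
  s-nonempty = ∣p∣≡1+k⇒Nonempty (two (Any-resp-⊆ σ⊆τ (here refl)))
  x : Fin _
  x = proj₁ s-nonempty
  x∈s : x ∈ₛ s
  x∈s = proj₂ s-nonempty
  x-absorbed : L σ ∪ ⁅ x ⁆ ⊆ₛ L σ
  x-absorbed = ∪-lub id (⁅⁆-elim (∈L⁺ {σ = σ} (here refl) x∈s))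

theorem4 : (n : ℕ) → 1 ≤ n → (τ : List (Subset n)) → Unique τ → TwoSubsets τ → L τ ≡ ⊤ →
    (Thin τ ⇔ Σ (Tree n) (λ t → IsPhylogenetic t × LcaInjective t τ))
    × (Thin τ ⇔ Σ (Tree n) (λ t → IsCaterpillar t × LcaInjective t τ))
theorem4 n 1≤n τ uτ two _ =
  mk⇔ (map₂ (map₁ proj₁) ∘ thin⇒caterpillar 1≤n two)
      (λ (_ , phylogenetic , li) → lcaInjective⇒thin uτ two phylogenetic li) ,
  mk⇔ (thin⇒caterpillar 1≤n two)
      (λ (_ , (phylogenetic , _) , li) → lcaInjective⇒thin uτ two phylogenetic li)
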